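{- Let $\mathcal{H}$ be a pre-Hilbert category and $X$ an object. The functor $(-)^\perp:\mathrm{ClSub}(X)^{\mathrm{op}}\to\mathrm{ClSub}(X)$ is an equivalence of categories; in particular it is both left and right adjoint to its opposite $((-)^\perp)^{\mathrm{op}}:\mathrm{ClSub}(X)\to\mathrm{ClSub}(X)^{\mathrm{op}}$. Equivalently, for all $m,n\in\mathrm{ClSub}(X)$, $m^\perp\le n$ if and only if $n^\perp\le m$.
   Context: A $\dagger$-category is a category $\mathcal{H}$ with a functor $\dagger:\mathcal{H}^{\mathrm{op}}\to\mathcal{H}$ that is the identity on objects with $f^{\dagger\dagger}=f$. A morphism $m$ is a $\dagger$-mono if $m^\dagger m=\mathrm{id}$. A pre-Hilbert category is a $\dagger$-category such that: it has finite $\dagger$-biproducts (finite biproducts, including a zero object, with $\pi^\dagger=\kappa$); it has finite $\dagger$-equalisers (equalisers that are $\dagger$-monos); every $\dagger$-mono is a kernel of some morphism; and it is symmetric $\dagger$-monoidal ($(f\otimes g)^\dagger=f^\dagger\otimes g^\dagger$, coherence isomorphisms $\dagger$-isos). Kernels are chosen to be $\dagger$-monos. A subobject of $X$ is an equivalence class of monos into $X$ (modulo isomorphism of domains commuting with the monos), ordered by factorisation; $\mathrm{ClSub}(X)$ is the poset (viewed as a category) of subobjects representable by a $\dagger$-mono. For a $\dagger$-mono $m$, $m^\perp=\ker(m^\dagger)$, which defines an order-reversing map $(-)^\perp:\mathrm{ClSub}(X)^{\mathrm{op}}\to\mathrm{ClSub}(X)$. -}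

module Defs where

open import Level using (Level; _⊔_) renaming (suc to lsuc)
open import Data.Product using (Σ; _×_; _,_; proj₁; proj₂)
open import Relation.Binary.Structures using (IsEquivalence)
open import Function.Bundles using (_⇔_)

record Category (o ℓ e : Level) : Set (lsuc (o ⊔ ℓ ⊔ e)) where
  infix  4 _≈_
  infixr 9 _∘_
  field
    Obj : Set o
    _⇒_ : Obj → Obj → Set ℓ
    _≈_ : ∀ {A B} → A ⇒ B → A ⇒ B → Set e
    id  : ∀ {A} → A ⇒ A
    _∘_ : ∀ {A B C} → B ⇒ C → A ⇒ B → A ⇒ C
    ≈-equiv   : ∀ {A B} → IsEquivalence (_≈_ {A} {B})
    assoc     : ∀ {A B C D} {f : A ⇒ B} {g : B ⇒ C} {h : C ⇒ D} →
                (h ∘ g) ∘ f ≈ h ∘ (g ∘ f)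
    identityˡ : ∀ {A B} {f : A ⇒ B} → id ∘ f ≈ f
    identityʳ : ∀ {A B} {f : A ⇒ B} → f ∘ id ≈ f
    ∘-resp-≈  : ∀ {A B C} {f h : B ⇒ C} {g i : A ⇒ B} →
                f ≈ h → g ≈ i → f ∘ g ≈ h ∘ i

record DaggerCategory (o ℓ e : Level) : Set (lsuc (o ⊔ ℓ ⊔ e)) where
  field
    category : Category o ℓ e
  open Category category public
  infix 15 _†
  field
    _†       : ∀ {A B} → A ⇒ B → B ⇒ A
    †-resp-≈ : ∀ {A B} {f g : A ⇒ B} → f ≈ g → f † ≈ g †
    †-id     : ∀ {A} → (id {A}) † ≈ id
    †-∘      : ∀ {A B C} {f : A ⇒ B} {g : B ⇒ C} → (g ∘ f) † ≈ f † ∘ g †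
    †-invol  : ∀ {A B} {f : A ⇒ B} → (f †) † ≈ f

module DaggerDefs {o ℓ e} (𝒞 : DaggerCategory o ℓ e) where
  open DaggerCategory 𝒞

  IsDaggerMono : ∀ {A B} → A ⇒ B → Set e
  IsDaggerMono m = m † ∘ m ≈ id

  IsDaggerIso : ∀ {A B} → A ⇒ B → Set e
  IsDaggerIso f = (f † ∘ f ≈ id) × (f ∘ f † ≈ id)

  record ZeroObject : Set (o ⊔ ℓ ⊔ e) where
    field
      𝟘     : Obj
      !     : ∀ {A} → A ⇒ 𝟘
      ¡     : ∀ {A} → 𝟘 ⇒ A
      !-unique : ∀ {A} (f : A ⇒ 𝟘) → f ≈ !
      ¡-unique : ∀ {A} (f : 𝟘 ⇒ A) → f ≈ ¡

  0m : ZeroObject → ∀ {A B} → A ⇒ B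
  0m Z = ZeroObject.¡ Z ∘ ZeroObject.! Z

  record IsEqualiser {E A B} (f g : A ⇒ B) (eq : E ⇒ A) : Set (o ⊔ ℓ ⊔ e) where
    field
      equality : f ∘ eq ≈ g ∘ eq
      factor   : ∀ {C} (h : C ⇒ A) → f ∘ h ≈ g ∘ h → C ⇒ E
      factor-≈ : ∀ {C} (h : C ⇒ A) (p : f ∘ h ≈ g ∘ h) → eq ∘ factor h p ≈ h
      factor-unique : ∀ {C} (h : C ⇒ A) (p : f ∘ h ≈ g ∘ h) (u : C ⇒ E) →
                      eq ∘ u ≈ h → u ≈ factor h p

  IsKernel : ZeroObject → ∀ {K A B} → A ⇒ B → K ⇒ A → Set (o ⊔ ℓ ⊔ e)
  IsKernel Z f k = IsEqualiser f (0m Z) k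

  record DaggerEqualiser {A B} (f g : A ⇒ B) : Set (o ⊔ ℓ ⊔ e) where
    field
      obj         : Obj
      arr         : obj ⇒ A
      isEqualiser : IsEqualiser f g arr
      isDaggerMono : IsDaggerMono arr

  -- † -biproducts (binary); with a zero object this gives finite ones
  record DaggerBiproduct (Z : ZeroObject) (A B : Obj) : Set (o ⊔ ℓ ⊔ e) where
    field
      A⊕B : Obj
      π₁ : A⊕B ⇒ A
      π₂ : A⊕B ⇒ B
      κ₁ : A ⇒ A⊕B
      κ₂ : B ⇒ A⊕B
      ⟨_,_⟩ : ∀ {C} → C ⇒ A → C ⇒ B → C ⇒ A⊕B
      π₁∘⟨⟩ : ∀ {C} {f : C ⇒ A} {g : C ⇒ B} → π₁ ∘ ⟨ f , g ⟩ ≈ f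
      π₂∘⟨⟩ : ∀ {C} {f : C ⇒ A} {g : C ⇒ B} → π₂ ∘ ⟨ f , g ⟩ ≈ g
      ⟨⟩-unique : ∀ {C} {f : C ⇒ A} {g : C ⇒ B} (h : C ⇒ A⊕B) →
                  π₁ ∘ h ≈ f → π₂ ∘ h ≈ g → h ≈ ⟨ f , g ⟩
      [_,_] : ∀ {C} → A ⇒ C → B ⇒ C → A⊕B ⇒ C
      []∘κ₁ : ∀ {C} {f : A ⇒ C} {g : B ⇒ C} → [ f , g ] ∘ κ₁ ≈ f
      []∘κ₂ : ∀ {C} {f : A ⇒ C} {g : B ⇒ C} → [ f , g ] ∘ κ₂ ≈ g
      []-unique : ∀ {C} {f : A ⇒ C} {g : B ⇒ C} (h : A⊕B ⇒ C) →
                  h ∘ κ₁ ≈ f → h ∘ κ₂ ≈ g → h ≈ [ f , g ]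
      π₁∘κ₁ : π₁ ∘ κ₁ ≈ id
      π₂∘κ₂ : π₂ ∘ κ₂ ≈ id
      π₁∘κ₂ : π₁ ∘ κ₂ ≈ 0m Z
      π₂∘κ₁ : π₂ ∘ κ₁ ≈ 0m Z
      π₁†≈κ₁ : π₁ † ≈ κ₁
      π₂†≈κ₂ : π₂ † ≈ κ₂

  record SymmetricDaggerMonoidal : Set (o ⊔ ℓ ⊔ e) where
    infixr 10 _⊗₀_ _⊗₁_
    field
      _⊗₀_ : Obj → Obj → Obj
      _⊗₁_ : ∀ {A B C D} → A ⇒ B → C ⇒ D → (A ⊗₀ C) ⇒ (B ⊗₀ D)
      unit : Obj
      ⊗-id    : ∀ {A B} → id {A} ⊗₁ id {B} ≈ id
      ⊗-∘     : ∀ {A B C D E F} {f : B ⇒ C} {g : A ⇒ B} {h : E ⇒ F} {i : D ⇒ E} →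
                (f ∘ g) ⊗₁ (h ∘ i) ≈ (f ⊗₁ h) ∘ (g ⊗₁ i)
      ⊗-resp-≈ : ∀ {A B C D} {f f′ : A ⇒ B} {g g′ : C ⇒ D} →
                 f ≈ f′ → g ≈ g′ → f ⊗₁ g ≈ f′ ⊗₁ g′
      ⊗-†     : ∀ {A B C D} {f : A ⇒ B} {g : C ⇒ D} → (f ⊗₁ g) † ≈ f † ⊗₁ g †
      α : ∀ {A B C} → ((A ⊗₀ B) ⊗₀ C) ⇒ (A ⊗₀ (B ⊗₀ C))
      λ⇒ : ∀ {A} → (unit ⊗₀ A) ⇒ A
      ρ⇒ : ∀ {A} → (A ⊗₀ unit) ⇒ A
      σ : ∀ {A B} → (A ⊗₀ B) ⇒ (B ⊗₀ A)
      α-dagger-iso : ∀ {A B C} → IsDaggerIso (α {A} {B} {C})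
      λ-dagger-iso : ∀ {A} → IsDaggerIso (λ⇒ {A})
      ρ-dagger-iso : ∀ {A} → IsDaggerIso (ρ⇒ {A})
      σ-dagger-iso : ∀ {A B} → IsDaggerIso (σ {A} {B})
      α-natural : ∀ {A A′ B B′ C C′} {f : A ⇒ A′} {g : B ⇒ B′} {h : C ⇒ C′} →
                  α ∘ ((f ⊗₁ g) ⊗₁ h) ≈ (f ⊗₁ (g ⊗₁ h)) ∘ α
      λ-natural : ∀ {A B} {f : A ⇒ B} → λ⇒ ∘ (id ⊗₁ f) ≈ f ∘ λ⇒
      ρ-natural : ∀ {A B} {f : A ⇒ B} → ρ⇒ ∘ (f ⊗₁ id) ≈ f ∘ ρ⇒
      σ-natural : ∀ {A A′ B B′} {f : A ⇒ A′} {g : B ⇒ B′} →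
                  σ ∘ (f ⊗₁ g) ≈ (g ⊗₁ f) ∘ σ
      pentagon : ∀ {A B C D} →
                 α {A} {B} {C ⊗₀ D} ∘ α {A ⊗₀ B} {C} {D}
                   ≈ (id ⊗₁ α {B} {C} {D}) ∘ (α {A} {B ⊗₀ C} {D} ∘ (α {A} {B} {C} ⊗₁ id))
      triangle : ∀ {A B} → (id {A} ⊗₁ λ⇒ {B}) ∘ α ≈ ρ⇒ ⊗₁ id
      hexagon  : ∀ {A B C} →
                 α {B} {C} {A} ∘ (σ {A} {B ⊗₀ C} ∘ α {A} {B} {C})
                   ≈ (id ⊗₁ σ {A} {C}) ∘ (α {B} {A} {C} ∘ (σ {A} {B} ⊗₁ id))
      σ-involutive : ∀ {A B} → σ {B} {A} ∘ σ {A} {B} ≈ id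

record PreHilbert (o ℓ e : Level) : Set (lsuc (o ⊔ ℓ ⊔ e)) where
  field
    daggerCategory : DaggerCategory o ℓ e
  open DaggerCategory daggerCategory public
  open DaggerDefs daggerCategory public
  field
    zeroObject  : ZeroObject
    biproduct   : ∀ A B → DaggerBiproduct zeroObject A B
    equaliser   : ∀ {A B} (f g : A ⇒ B) → DaggerEqualiser f g
    dmono⇒kernel : ∀ {M X} (m : M ⇒ X) → IsDaggerMono m →
                   Σ Obj λ Y → Σ (X ⇒ Y) λ f → IsKernel zeroObject f m
    monoidal    : SymmetricDaggerMonoidal

  Ker : ∀ {A B} → A ⇒ B → Obj
  Ker f = DaggerEqualiser.obj (equaliser f (0m zeroObject))

  ker : ∀ {A B} (f : A ⇒ B) → Ker f ⇒ A
  ker f = DaggerEqualiser.arr (equaliser f (0m zeroObject))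

  ker-dmono : ∀ {A B} (f : A ⇒ B) → IsDaggerMono (ker f)
  ker-dmono f = DaggerEqualiser.isDaggerMono (equaliser f (0m zeroObject))

  -- representatives of closed subobjects of X: † -monos into X
  record ClSub (X : Obj) : Set (o ⊔ ℓ ⊔ e) where
    constructor clsub
    field
      dom   : Obj
      arr   : dom ⇒ X
      dmono : IsDaggerMono arr

  infix 4 _≤ₛ_ _≅ₛ_
  _≤ₛ_ : ∀ {X} → ClSub X → ClSub X → Set (ℓ ⊔ e)
  m ≤ₛ n = Σ (ClSub.dom m ⇒ ClSub.dom n) λ h → ClSub.arr n ∘ h ≈ ClSub.arr m

  _≅ₛ_ : ∀ {X} → ClSub X → ClSub X → Set (ℓ ⊔ e)
  m ≅ₛ n = (m ≤ₛ n) × (n ≤ₛ m)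

  infix 20 _⊥
  _⊥ : ∀ {X} → ClSub X → ClSub X
  m ⊥ = clsub (Ker (ClSub.arr m †)) (ker (ClSub.arr m †)) (ker-dmono (ClSub.arr m †))

-- Complementation is antitone and m ≤ m⊥⊥ holds for every morphism m. Conversely, if
-- m is a kernel of f then m† f† = (f m)† = 0, so f† factors through k = ker(m†) and
-- f = g† k†; hence f kills ker(k†) = m⊥⊥, which therefore factors through m. Since every
-- †-mono is a kernel, m⊥⊥ ≅ m, and (-)⊥ is an order-reversing involution of ClSub(X).
module Submission where

open import Defs
open import Data.Product using (Σ; _×_; _,_; proj₁; proj₂)
open import Function.Bundles using (_⇔_; mk⇔)
open import Relation.Binary.Bundles using (Setoid)
open import Relation.Binary.Structures using (IsEquivalence)
import Relation.Binary.Reasoning.Setoid as SetoidReasoning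

module ZeroMorphisms {o ℓ e} (𝒞 : DaggerCategory o ℓ e) (Z : DaggerDefs.ZeroObject 𝒞) where
  open DaggerCategory 𝒞
  open DaggerDefs 𝒞
  open ZeroObject Z

  module ≈ {A B} = IsEquivalence (≈-equiv {A} {B})

  hom-setoid : Obj → Obj → Setoid ℓ e
  hom-setoid A B = record { Carrier = A ⇒ B ; _≈_ = _≈_ ; isEquivalence = ≈-equiv }

  module HomReasoning {A B} = SetoidReasoning (hom-setoid A B)
  open HomReasoning

  0m-absorbˡ : ∀ {A B C} (f : A ⇒ B) → 0m Z {B} {C} ∘ f ≈ 0m Z
  0m-absorbˡ f = ≈.trans assoc (∘-resp-≈ ≈.refl (!-unique _))

  0m-absorbʳ : ∀ {A B C} (f : B ⇒ C) → f ∘ 0m Z {A} {B} ≈ 0m Z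
  0m-absorbʳ f = ≈.trans (≈.sym assoc) (∘-resp-≈ (¡-unique _) ≈.refl)

  0m-† : ∀ {A B} → 0m Z {A} {B} † ≈ 0m Z
  0m-† = ≈.trans †-∘ (∘-resp-≈ (¡-unique _) (!-unique _))

  †-annihilates : ∀ {A B C} {f : B ⇒ C} {g : A ⇒ B} → f ∘ g ≈ 0m Z → g † ∘ f † ≈ 0m Z
  †-annihilates {f = f} {g} fg≈0 = begin
    g † ∘ f †   ≈⟨ ≈.sym †-∘ ⟩
    (f ∘ g) †   ≈⟨ †-resp-≈ fg≈0 ⟩
    0m Z †      ≈⟨ 0m-† ⟩
    0m Z        ∎

  module _ {K A B} {f : A ⇒ B} {k : K ⇒ A} (isKernel : IsKernel Z f k) where
    open IsEqualiser isKernel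

    kernel-annihilates : f ∘ k ≈ 0m Z
    kernel-annihilates = ≈.trans equality (0m-absorbˡ k)

    factor-through-kernel : ∀ {C} (h : C ⇒ A) → f ∘ h ≈ 0m Z → Σ (C ⇒ K) λ u → k ∘ u ≈ h
    factor-through-kernel h fh≈0 = factor h p , factor-≈ h p
      where p = ≈.trans fh≈0 (≈.sym (0m-absorbˡ h))

module ClosedSubobjects {o ℓ e} (H : PreHilbert o ℓ e) where
  open PreHilbert H
  open ZeroMorphisms daggerCategory zeroObject
  open HomReasoning
  open ClSub

  ker-isKernel : ∀ {A B} (f : A ⇒ B) → IsKernel zeroObject f (ker f)
  ker-isKernel f = DaggerEqualiser.isEqualiser (equaliser f (0m zeroObject))

  ≤ₛ-trans : ∀ {X} (a b c : ClSub X) → a ≤ₛ b → b ≤ₛ c → a ≤ₛ c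
  ≤ₛ-trans a b c (h , bh≈a) (k , ck≈b) = k ∘ h , (begin
    arr c ∘ (k ∘ h)   ≈⟨ ≈.sym assoc ⟩
    (arr c ∘ k) ∘ h   ≈⟨ ∘-resp-≈ ck≈b ≈.refl ⟩
    arr b ∘ h         ≈⟨ bh≈a ⟩
    arr a             ∎)

  ⊥-antitone : ∀ {X} (m n : ClSub X) → n ≤ₛ m → m ⊥ ≤ₛ n ⊥
  ⊥-antitone m n (h , mh≈n) =
    factor-through-kernel (ker-isKernel (arr n †)) (ker (arr m †)) (begin
      arr n † ∘ ker (arr m †)           ≈⟨ ∘-resp-≈ (†-resp-≈ (≈.sym mh≈n)) ≈.refl ⟩
      (arr m ∘ h) † ∘ ker (arr m †)     ≈⟨ ∘-resp-≈ †-∘ ≈.refl ⟩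
      (h † ∘ arr m †) ∘ ker (arr m †)   ≈⟨ assoc ⟩
      h † ∘ (arr m † ∘ ker (arr m †))   ≈⟨ ∘-resp-≈ ≈.refl (kernel-annihilates (ker-isKernel _)) ⟩
      h † ∘ 0m zeroObject               ≈⟨ 0m-absorbʳ _ ⟩
      0m zeroObject                     ∎)

  ≤-⊥⊥ : ∀ {X} (m : ClSub X) → m ≤ₛ m ⊥ ⊥
  ≤-⊥⊥ m = factor-through-kernel (ker-isKernel (ker (arr m †) †)) (arr m) (begin
    ker (arr m †) † ∘ arr m       ≈⟨ ∘-resp-≈ ≈.refl (≈.sym †-invol) ⟩
    ker (arr m †) † ∘ arr m † †   ≈⟨ †-annihilates (kernel-annihilates (ker-isKernel _)) ⟩
    0m zeroObject                 ∎)

  kernel-⊥⊥-factors : ∀ {M A B} {f : A ⇒ B} {m : M ⇒ A} → IsKernel zeroObject f m →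
                      Σ (Ker (ker (m †) †) ⇒ M) λ u → m ∘ u ≈ ker (ker (m †) †)
  kernel-⊥⊥-factors {f = f} {m} isKernel =
    factor-through-kernel isKernel (ker (k †)) (begin
      f ∘ ker (k †)               ≈⟨ ∘-resp-≈ f≈g†k† ≈.refl ⟩
      (g † ∘ k †) ∘ ker (k †)     ≈⟨ assoc ⟩
      g † ∘ (k † ∘ ker (k †))     ≈⟨ ∘-resp-≈ ≈.refl (kernel-annihilates (ker-isKernel _)) ⟩
      g † ∘ 0m zeroObject         ≈⟨ 0m-absorbʳ _ ⟩
      0m zeroObject               ∎)
    where
      k : Ker (m †) ⇒ _
      k = ker (m †)
      f†-through-k : Σ (_ ⇒ Ker (m †)) λ g → k ∘ g ≈ f †
      f†-through-k = factor-through-kernel (ker-isKernel (m †)) (f †)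
                       (†-annihilates (kernel-annihilates isKernel))
      g : _ ⇒ Ker (m †)
      g = proj₁ f†-through-k
      f≈g†k† : f ≈ g † ∘ k †
      f≈g†k† = begin
        f             ≈⟨ ≈.sym †-invol ⟩
        f † †         ≈⟨ †-resp-≈ (≈.sym (proj₂ f†-through-k)) ⟩
        (k ∘ g) †     ≈⟨ †-∘ ⟩
        g † ∘ k †     ∎

  ⊥⊥-≤ : ∀ {X} (m : ClSub X) → m ⊥ ⊥ ≤ₛ m
  ⊥⊥-≤ m = kernel-⊥⊥-factors (proj₂ (proj₂ (dmono⇒kernel (arr m) (dmono m))))

  ⊥-galois : ∀ {X} (m n : ClSub X) → m ⊥ ≤ₛ n → n ⊥ ≤ₛ m
  ⊥-galois m n m⊥≤n = ≤ₛ-trans (n ⊥) (m ⊥ ⊥) m (⊥-antitone n (m ⊥) m⊥≤n) (⊥⊥-≤ m)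

  ⊥-reflects : ∀ {X} (m n : ClSub X) → m ⊥ ≤ₛ n ⊥ → n ≤ₛ m
  ⊥-reflects m n m⊥≤n⊥ = ≤ₛ-trans n (n ⊥ ⊥) m (≤-⊥⊥ n) (⊥-galois m (n ⊥) m⊥≤n⊥)

lemma9 : ∀ {o ℓ e} (H : PreHilbert o ℓ e) (X : PreHilbert.Obj H) →
    let open PreHilbert H in
    ((m n : ClSub X) → (n ≤ₛ m) ⇔ (m ⊥ ≤ₛ n ⊥))
    × ((n : ClSub X) → Σ (ClSub X) (λ m → m ⊥ ≅ₛ n))
    × ((m n : ClSub X) → (m ⊥ ≤ₛ n) ⇔ (n ⊥ ≤ₛ m))
lemma9 H X =
    (λ m n → mk⇔ (⊥-antitone m n) (⊥-reflects m n))
  , (λ n → n ⊥ , ⊥⊥-≤ n , ≤-⊥⊥ n)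
  , (λ m n → mk⇔ (⊥-galois m n) (⊥-galois n m))
  where
    open PreHilbert H
    open ClosedSubobjects H
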